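{- Let $0<\gamma<1/3$ and $k\in\mathbb{N}$, let $n$ be sufficiently large (in terms of $\gamma$ and $k$), and let $H$ be a two-coloured complete graph with at least $(1+3\gamma)2^n$ vertices, no blue triangle, and $d_B(u)\leqslant 2^n/\log_{(k)}(n)$ for every $u\in V(H)$. Let $(d_i,S_i,\mathbf{x}_i)_{i=1}^m$ be a partial assignment of the cube $Q_n$ into $H$. Then there exists an embedding \[ \varphi\colon \bigcup_{i=1}^m V(Q_{\mathbf{x}_i})\to V(H) \] of the subgraph $\bigcup_{i=1}^m Q_{\mathbf{x}_i}$ of $Q_n$ into $H_R$ (i.e. an injective map sending edges to red edges) such that $\varphi(V(Q_{\mathbf{x}_i}))\subset S_i$ for each $i\in[m]$.
   Context: $Q_n$ is the hypercube on $\{0,1\}^n$ (edges between vectors differing in exactly one coordinate). $H_R,H_B$ are the red and blue graphs; $N_B(v)$, $d_B(v)$ are the blue neighbourhood and degree. Logs are base 2; $\log_{(k)}$ is the $k$-fold iterated logarithm. For $d\geqslant 0$ and $\mathbf{x}=(x_1,\dots,x_d)\in\{0,1\}^d$, the initial subcube $Q_{\mathbf{x}}$ is the subcube of $Q_n$ induced by $\{(y_1,\dots,y_n)\in\{0,1\}^n: y_i=x_i \text{ for } 1\leqslant i\leqslant d\}$; $d$ is its co-dimension. For $\mathbf{x}\in\{0,1\}^d$, $\mathbf{z}\in\{0,1\}^{d'}$ let $d(\mathbf{x},\mathbf{z})=\sum_{i=1}^{\min\{d,d'\}}|x_i-z_i|$, and write $\mathbf{x}\sim\mathbf{z}$ if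 $d(\mathbf{x},\mathbf{z})=1$. For a collection of disjoint subcubes, $\bigcup_i Q_{\mathbf{x}_i}$ denotes the subgraph of $Q_n$ induced by $\bigcup_i V(Q_{\mathbf{x}_i})$. A partial assignment of the cube $Q_n$ into $H$ is a tuple $(d_i,S_i,\mathbf{x}_i)_{i=1}^m$ ($m\in\mathbb{N}$) where: integers $0\leqslant d_1\leqslant\cdots\leqslant d_m\leqslant n$; $S_1,\dots,S_m\subset V(H)$ are disjoint with $|S_i|=(1+\gamma)2^{n-d_i}$ and each $S_i$ induces a red clique in $H$; $\mathbf{x}_i\in\{0,1\}^{d_i}$ with the subcubes $Q_{\mathbf{x}_i}$ pairwise disjoint; and for each pair $i<j$ with $\mathbf{x}_i\sim\mathbf{x}_j$ and every $v\in S_j$, $|N_B(v)\cap S_i|\leqslant \frac{\gamma}{d_i}2^{n-d_i}$. -}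

module Defs where

open import Data.Bool using (Bool; true; false; _xor_)
open import Data.Nat as ℕ using (ℕ; zero; suc; _∸_)
open import Data.Integer as ℤ using (ℤ; +_; -[1+_])
open import Data.Rational as ℚ using (ℚ; 0ℚ; 1ℚ; _+_; _*_; _<_; _≤_; ↥_; ↧ₙ_)
open import Data.Fin using (Fin)
import Data.Fin
open import Data.Fin.Subset using (Subset; _∈_; _∩_; ∣_∣)
open import Data.Vec using (Vec; tabulate; toList; take; lookup)
open import Data.List using (List; []; _∷_)
open import Data.Product using (Σ; ∃; _×_; _,_)
open import Relation.Binary.PropositionalEquality using (_≡_; _≢_)
open import Relation.Nullary using (¬_; yes; no)
open import Data.Fin using (_≟_)

fromℕ : ℕ → ℚ
fromℕ n = (+ n) ℚ./ 1

_^ℚ_ : ℚ → ℕ → ℚ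
q ^ℚ zero  = 1ℚ
q ^ℚ suc k = q * (q ^ℚ k)

two : ℚ
two = fromℕ 2

-- Pow2Lt r s  :⇔  2^r < s  (for s > 0), with r = p/q :
-- 2^(p/q) < s  ⇔  2^p < s^q   (written without negative powers).
Pow2Lt : ℚ → ℚ → Set
Pow2Lt r s with ↥ r
... | + a      = (two ^ℚ a) < (s ^ℚ (↧ₙ r))
... | -[1+ a ] = 1ℚ < ((s ^ℚ (↧ₙ r)) * (two ^ℚ (suc a)))

-- r <log[ j ] n  :⇔  r < log_(j)(n), the j-fold iterated base-2 logarithm
-- (log_(0)(n) = n).  Defined through rational lower bounds:
-- r < log₂ y  ⇔  ∃ rational s with 0 < s < y and 2^r < s.
-- (If some iterate is undefined/non-positive, no r qualifies.)
_<log[_]_ : ℚ → ℕ → ℕ → Set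
r <log[ zero ] n  = r < fromℕ n
r <log[ suc j ] n = ∃ λ s → (s <log[ j ] n) × (0ℚ < s) × Pow2Lt r s

-- d · log_(k)(n) ≤ 2^n, i.e.  d ≤ 2^n / log_(k)(n)  (d a natural number).
DegBound : ℕ → ℕ → ℕ → Set
DegBound k n d = ∀ r → r <log[ k ] n → fromℕ d * r ≤ fromℕ (2 ℕ.^ n)

-- Two-coloured complete graphs on vertex set Fin M.
-- blue u v = true: edge uv blue; false: red (for u ≢ v).

record TwoColouring (M : ℕ) : Set where
  field
    blue    : Fin M → Fin M → Bool
    blueSym : ∀ u v → blue u v ≡ blue v u

module _ {M : ℕ} (H : TwoColouring M) where
  open TwoColouring H

  Red : Fin M → Fin M → Set
  Red u v = u ≢ v × blue u v ≡ false

  NB : Fin M → Subset M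
  NB u = tabulate λ v → blueIfDistinct v
    where
    blueIfDistinct : Fin M → Bool
    blueIfDistinct v with u ≟ v
    ... | yes _ = false
    ... | no  _ = blue u v

  dB : Fin M → ℕ
  dB u = ∣ NB u ∣

  NoBlueTriangle : Set
  NoBlueTriangle = ∀ a b c → a ≢ b → b ≢ c → a ≢ c →
    ¬ (blue a b ≡ true × blue b c ≡ true × blue a c ≡ true)

  RedClique : Subset M → Set
  RedClique S = ∀ u v → u ∈ S → v ∈ S → u ≢ v → blue u v ≡ false

dist : List Bool → List Bool → ℕ
dist (a ∷ as) (b ∷ bs) = (if' (a xor b)) ℕ.+ dist as bs
  where
  if' : Bool → ℕ
  if' true  = 1
  if' false = 0
dist _ _ = 0

_∼_ : List Bool → List Bool → Set
x ∼ z = dist x z ≡ 1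

-- y ∈ V(Q_x) for x ∈ {0,1}^d, y ∈ {0,1}^n: y_i = x_i for i ≤ d
InCube : ∀ {n d} → Vec Bool n → Vec Bool d → Set
InCube {n} {d} y x = ∀ (j : Fin d) → Σ (Fin n) λ j' →
  (Data.Fin.toℕ j' ≡ Data.Fin.toℕ j) × (lookup y j' ≡ lookup x j)

CubeEdge : ∀ {n} → Vec Bool n → Vec Bool n → Set
CubeEdge y y' = dist (toList y) (toList y') ≡ 1

record PartialAssignment (γ : ℚ) (n : ℕ) {M : ℕ} (H : TwoColouring M) (m : ℕ) : Set where
  field
    d      : Fin m → ℕ
    d-mono : ∀ i j → i Data.Fin.≤ j → d i ℕ.≤ d j
    d≤n    : ∀ i → d i ℕ.≤ n
    S      : Fin m → Subset M
    S-disj : ∀ i j → i ≢ j → ∀ v → v ∈ S i → ¬ (v ∈ S j)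
    S-size : ∀ i → fromℕ ∣ S i ∣ ≡ (1ℚ + γ) * fromℕ (2 ℕ.^ (n ∸ d i))
    S-red  : ∀ i → RedClique H (S i)
    x      : (i : Fin m) → Vec Bool (d i)
    Q-disj : ∀ i j → i ≢ j → ∀ (y : Vec Bool n) → InCube y (x i) → ¬ InCube y (x j)
    -- |N_B(v) ∩ S_i| ≤ (γ / d_i) 2^(n - d_i), multiplied through by d_i
    -- (x_i ∼ x_j forces d_i ≥ 1)
    blueBd : ∀ i j → i Data.Fin.< j → toList (x i) ∼ toList (x j) →
             ∀ v → v ∈ S j →
             fromℕ (∣ NB H v ∩ S i ∣ ℕ.* d i) ≤ γ * fromℕ (2 ℕ.^ (n ∸ d i))

-- φ is an embedding of ⋃ Q_{x_i} into H_R with φ(V(Q_{x_i})) ⊆ S_i.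
-- φ is given as a total map on {0,1}^n; only its values on the union matter.
record GoodEmbedding {γ n M m} {H : TwoColouring M} (A : PartialAssignment γ n H m)
                     (φ : Vec Bool n → Fin M) : Set where
  open PartialAssignment A
  InUnion : Vec Bool n → Set
  InUnion y = ∃ λ i → InCube y (x i)
  field
    inj    : ∀ y y' → InUnion y → InUnion y' → φ y ≡ φ y' → y ≡ y'
    red    : ∀ y y' → InUnion y → InUnion y' → CubeEdge y y' →
             TwoColouring.blue H (φ y) (φ y') ≡ false
    inS    : ∀ i y → InCube y (x i) → φ y ∈ S i

module Submission where

-- The embedding is greedy.  The subcubes are embedded one at a time in
-- decreasing order of index, and inside Q_{x c} vertex by vertex.  A vertex y
-- of Q_{x c} must avoid the images already used in S c (fewer than 2^{n - d c})
-- and the blue neighbourhoods of the images of its placed neighbours.  Placed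
-- neighbours inside Q_{x c} block nothing, because S c is a red clique; a
-- placed neighbour in another subcube Q_{x c'} has c < c', differs from y in
-- one of the first d c coordinates, and x c ∼ x c', so it blocks at most
-- γ 2^{n - d c} / d c points of S c.  Altogether fewer than (1 + γ) 2^{n - d c}
-- = |S c| points are blocked, so a free point exists.  No largeness of n is
-- needed, and of the hypotheses on H only that it has a vertex is used.

module AvoidingSets where

  open import Data.Bool using (Bool; true; false; _∧_)
  open import Data.Nat as ℕ using (ℕ; _+_; _≤_; _<_; z≤n; s≤s)
  import Data.Nat.Properties as ℕₚ
  open import Data.Nat.ListAction using (sum)
  open import Data.Nat.ListAction.Properties using (sum-++)
  open import Data.Fin using (Fin; zero; suc)
  open import Data.Fin.Subset using (Subset; _∈_; _∉_; _∩_; ∣_∣; ⊥)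
  open import Data.Fin.Subset.Properties using (_∈?_; p⊆q⇒∣p∣≤∣q∣; ∣⊥∣≡0; x∈p∩q⁻)
  open import Data.Vec as Vec using (_∷_; head; tail; here; there)
  open import Data.List using (List; []; _∷_; map; _++_)
  open import Data.List.Properties using (map-++)
  open import Data.List.Relation.Unary.Any as Any using (Any; here; there)
  open import Data.List.Relation.Unary.All using (All; all?)
  open import Data.List.Relation.Unary.All.Properties.Core using (¬All⇒Any¬)
  open import Data.Product using (_×_; _,_)
  open import Function using (_∘_)
  open import Data.Empty using (⊥-elim)
  import Data.Empty
  open import Relation.Nullary using (Dec; yes; no; ¬?)
  open import Relation.Nullary.Decidable using (decidable-stable; _×-dec_)
  open import Relation.Binary.PropositionalEquality using (_≡_; refl; trans; cong; cong₂)
  open import Data.Fin.Properties using (any?)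
  open import Data.Nat.Tactic.RingSolver using (solve-∀)

  variable
    M : ℕ

  -- load S Bs = Σ_{B ∈ Bs} |B ∩ S| bounds how much of S the sets in Bs can block.
  load : Subset M → List (Subset M) → ℕ
  load S Bs = sum (map (λ B → ∣ B ∩ S ∣) Bs)

  load-++ : (S : Subset M) (As Bs : List (Subset M)) →
    load S (As ++ Bs) ≡ load S As + load S Bs
  load-++ {M} S As Bs = trans (cong sum (map-++ size As Bs)) (sum-++ (map size As) (map size Bs))
    where
    size : Subset M → ℕ
    size B = ∣ B ∩ S ∣

  -- Ingredients of the union bound, which is proved by induction on the ground
  -- set: its first point contributes to the load of every set containing it.
  bit : Bool → ℕ
  bit true  = 1
  bit false = 0

  ∣∷∣ : ∀ b (B : Subset M) → ∣ b ∷ B ∣ ≡ bit b + ∣ B ∣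
  ∣∷∣ true  B = refl
  ∣∷∣ false B = refl

  load-∷ : ∀ s (S : Subset M) Bs →
    load (s ∷ S) Bs ≡ sum (map (λ B → bit (head B ∧ s)) Bs) + load S (map tail Bs)
  load-∷ s S []             = refl
  load-∷ s S ((b ∷ B) ∷ Bs) =
    trans (cong₂ _+_ (∣∷∣ (b ∧ s) (B ∩ S)) (load-∷ s S Bs))
          (interchange (bit (b ∧ s)) ∣ B ∩ S ∣ _ _)
    where
    interchange : ∀ a b c d → (a + b) + (c + d) ≡ (a + c) + (b + d)
    interchange = solve-∀

  first-point : (Bs : List (Subset (ℕ.suc M))) → Any (zero ∈_) Bs →
    1 ≤ sum (map (λ B → bit (head B ∧ true)) Bs)
  first-point ((true ∷ _) ∷ Bs) (here here) = s≤s z≤n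
  first-point (B ∷ Bs)          (there p)   =
    ℕₚ.≤-trans (first-point Bs p) (ℕₚ.m≤n+m _ (bit (head B ∧ true)))

  tail-covers : ∀ (u : Fin M) (Bs : List (Subset (ℕ.suc M))) → Any (suc u ∈_) Bs →
                Any (u ∈_) (map tail Bs)
  tail-covers u ((b ∷ B) ∷ Bs) (here (there p)) = here p
  tail-covers u (B ∷ Bs)       (there p)        = there (tail-covers u Bs p)

  union-bound : (S : Subset M) (Bs : List (Subset M)) →
    (∀ u → u ∈ S → Any (u ∈_) Bs) → ∣ S ∣ ≤ load S Bs
  union-bound Vec.[]  Bs covered = z≤n
  union-bound (s ∷ S) Bs covered rewrite ∣∷∣ s S | load-∷ s S Bs =
    ℕₚ.+-mono-≤ (first s covered)
                (union-bound S (map tail Bs) λ u u∈S → tail-covers u Bs (covered (suc u) (there u∈S)))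
    where
    first : ∀ s → (∀ u → u ∈ s ∷ S → Any (u ∈_) Bs) →
            bit s ≤ sum (map (λ B → bit (head B ∧ s)) Bs)
    first false _       = z≤n
    first true  covered = first-point Bs (covered zero here)

  Avoids : Subset M → List (Subset M) → Fin M → Set
  Avoids S Bs u = u ∈ S × All (u ∉_) Bs

  avoids? : (S : Subset M) (Bs : List (Subset M)) (u : Fin M) → Dec (Avoids S Bs u)
  avoids? S Bs u = (u ∈? S) ×-dec all? (λ B → ¬? (u ∈? B)) Bs

  choose : Fin M → Subset M → List (Subset M) → Fin M
  choose default S Bs with any? (avoids? S Bs)
  ... | yes (u , _) = u
  ... | no  _       = default

  choose-avoids : (default : Fin M) (S : Subset M) (Bs : List (Subset M)) →
    load S Bs < ∣ S ∣ → Avoids S Bs (choose default S Bs)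
  choose-avoids default S Bs small with any? (avoids? S Bs)
  ... | yes (_ , avoids) = avoids
  ... | no  none         = ⊥-elim (ℕₚ.<⇒≱ small (union-bound S Bs covered))
    where
    covered : ∀ u → u ∈ S → Any (u ∈_) Bs
    covered u u∈S = Any.map (λ {B} ¬u∉B → decidable-stable (u ∈? B) ¬u∉B)
      (¬All⇒Any¬ (λ B → ¬? (u ∈? B)) Bs λ u∉Bs → none (u , u∈S , u∉Bs))

  disjoint⇒∣∩∣≡0 : (B S : Subset M) → (∀ v → v ∈ S → v ∉ B) → ∣ B ∩ S ∣ ≡ 0
  disjoint⇒∣∩∣≡0 {M} B S disjoint =
    ℕₚ.n≤0⇒n≡0 (ℕₚ.≤-trans (p⊆q⇒∣p∣≤∣q∣ {p = B ∩ S} {q = ⊥} (⊥-elim ∘ common))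
                           (ℕₚ.≤-reflexive (∣⊥∣≡0 M)))
    where
    common : ∀ {v} → v ∈ B ∩ S → Data.Empty.⊥
    common {v} v∈B∩S with x∈p∩q⁻ B S v∈B∩S
    ... | v∈B , v∈S = disjoint v v∈S v∈B

module Subcubes where

  open import Defs using (dist; _∼_; InCube; CubeEdge)
  open import Data.Bool using (Bool; true; false; not)
  open import Data.Bool.Properties using (xor-comm; xor-same; xor-inverseʳ)
  open import Data.Nat using (ℕ; zero; suc; _+_; _≤_; _<_; _∸_; _^_; z≤n; s≤s)
  import Data.Nat.Properties as ℕₚ
  open import Data.Fin as Fin using (Fin; toℕ)
  open import Data.Vec using (Vec; []; _∷_; toList)
  open import Data.List using (List; []; _∷_; map; _++_; length)
  open import Data.List.Properties using (length-++; length-map)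
  open import Data.List.Membership.Propositional using (_∈_)
  open import Data.List.Membership.Propositional.Properties using (∈-map⁺; ∈-++⁺ˡ; ∈-++⁺ʳ)
  open import Data.List.Relation.Unary.Any using (here)
  open import Data.Product using (∃; _×_; _,_)
  open import Data.Sum using (_⊎_; inj₁; inj₂)
  open import Data.Unit using (⊤; tt)
  open import Data.Empty using (⊥)
  open import Relation.Nullary using (¬_)
  open import Relation.Binary.PropositionalEquality

  -- Prefix xs y : the word xs is an initial segment of the vertex y.
  -- This is InCube y x for xs = toList x, in a form suited to induction.
  Prefix : ∀ {n} → List Bool → Vec Bool n → Set
  Prefix []       _        = ⊤
  Prefix (b ∷ bs) []       = ⊥
  Prefix (b ∷ bs) (y ∷ ys) = b ≡ y × Prefix bs ys

  InCube⇒Prefix : ∀ {n d} (y : Vec Bool n) (x : Vec Bool d) → InCube y x → Prefix (toList x) y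
  InCube⇒Prefix y       []      _  = tt
  InCube⇒Prefix []      (b ∷ x) in-cube with in-cube Fin.zero
  ... | () , _
  InCube⇒Prefix (c ∷ y) (b ∷ x) in-cube with in-cube Fin.zero
  ... | Fin.zero  , _  , c≡b = sym c≡b , InCube⇒Prefix y x in-tail
    where
    in-tail : InCube y x
    in-tail j with in-cube (Fin.suc j)
    ... | Fin.suc j' , j'≡j , agree = j' , ℕₚ.suc-injective j'≡j , agree
  ... | Fin.suc _ , () , _

  Prefix⇒InCube : ∀ {n d} (y : Vec Bool n) (x : Vec Bool d) → Prefix (toList x) y → InCube y x
  Prefix⇒InCube (c ∷ y) (b ∷ x) (b≡c , _) Fin.zero = Fin.zero , refl , sym b≡c
  Prefix⇒InCube (c ∷ y) (b ∷ x) (_ , pre) (Fin.suc j) with Prefix⇒InCube y x pre j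
  ... | j' , j'≡j , agree = Fin.suc j' , cong suc j'≡j , agree

  flipAt : ∀ {n} → Fin n → Vec Bool n → Vec Bool n
  flipAt Fin.zero    (b ∷ y) = not b ∷ y
  flipAt (Fin.suc t) (b ∷ y) = b ∷ flipAt t y

  dist-refl : ∀ xs → dist xs xs ≡ 0
  dist-refl []          = refl
  dist-refl (true  ∷ xs) = dist-refl xs
  dist-refl (false ∷ xs) = dist-refl xs

  dist≡0⇒≡ : ∀ {n} (y y' : Vec Bool n) → dist (toList y) (toList y') ≡ 0 → y ≡ y'
  dist≡0⇒≡ []          []           _ = refl
  dist≡0⇒≡ (true  ∷ y) (true  ∷ y') e = cong (true  ∷_) (dist≡0⇒≡ y y' e)
  dist≡0⇒≡ (false ∷ y) (false ∷ y') e = cong (false ∷_) (dist≡0⇒≡ y y' e)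

  dist-sym : ∀ xs ys → dist xs ys ≡ dist ys xs
  dist-sym []       []       = refl
  dist-sym []       (_ ∷ _)  = refl
  dist-sym (_ ∷ _)  []       = refl
  dist-sym (a ∷ xs) (b ∷ ys) rewrite xor-comm a b | dist-sym xs ys = refl

  CubeEdge-irrefl : ∀ {n} (y : Vec Bool n) → ¬ CubeEdge y y
  CubeEdge-irrefl y e with trans (sym e) (dist-refl (toList y))
  ... | ()

  CubeEdge-sym : ∀ {n} (y y' : Vec Bool n) → CubeEdge y y' → CubeEdge y' y
  CubeEdge-sym y y' e = trans (dist-sym (toList y') (toList y)) e

  CubeEdge⇒flip : ∀ {n} (y y' : Vec Bool n) → CubeEdge y y' → ∃ λ t → y' ≡ flipAt t y
  CubeEdge⇒flip (true  ∷ y) (true  ∷ y') e with CubeEdge⇒flip y y' e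
  ... | t , y'≡ = Fin.suc t , cong (true ∷_) y'≡
  CubeEdge⇒flip (false ∷ y) (false ∷ y') e with CubeEdge⇒flip y y' e
  ... | t , y'≡ = Fin.suc t , cong (false ∷_) y'≡
  CubeEdge⇒flip (true  ∷ y) (false ∷ y') e =
    Fin.zero , cong (false ∷_) (sym (dist≡0⇒≡ y y' (ℕₚ.suc-injective e)))
  CubeEdge⇒flip (false ∷ y) (true  ∷ y') e =
    Fin.zero , cong (true  ∷_) (sym (dist≡0⇒≡ y y' (ℕₚ.suc-injective e)))

  -- Two prefixes of the same vertex are comparable, so they are at distance 0.
  prefixes-agree : ∀ {n} xs xs' (y : Vec Bool n) → Prefix xs y → Prefix xs' y → dist xs xs' ≡ 0
  prefixes-agree []       _          _       _             _             = refl
  prefixes-agree (_ ∷ _)  []         _       _             _             = refl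
  prefixes-agree (b ∷ xs) (.b ∷ xs') (.b ∷ y) (refl , pre) (refl , pre') rewrite xor-same b =
    prefixes-agree xs xs' y pre pre'

  edge-between-subcubes : ∀ {n} xs xs' (t : Fin n) (y : Vec Bool n) →
    Prefix xs y → Prefix xs' (flipAt t y) →
    Prefix xs (flipAt t y) ⊎ Prefix xs' y ⊎ (xs ∼ xs' × toℕ t < length xs)
  edge-between-subcubes []       _          _           _        _            _    = inj₁ tt
  edge-between-subcubes (_ ∷ _)  []         _           _        _            _    = inj₂ (inj₁ tt)
  edge-between-subcubes (b ∷ xs) (b' ∷ xs') Fin.zero    (.b ∷ y) (refl , pre) (refl , pre')
    rewrite xor-inverseʳ b = inj₂ (inj₂ (cong suc (prefixes-agree xs xs' y pre pre') , s≤s z≤n))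
  edge-between-subcubes (b ∷ xs) (b' ∷ xs') (Fin.suc t) (.b ∷ y) (refl , pre) (refl , pre')
    with edge-between-subcubes xs xs' t y pre pre'
  ... | inj₁ pre-flip                 = inj₁ (refl , pre-flip)
  ... | inj₂ (inj₁ pre'-y)            = inj₂ (inj₁ (refl , pre'-y))
  ... | inj₂ (inj₂ (adjacent , t<d)) rewrite xor-same b = inj₂ (inj₂ (adjacent , s≤s t<d))

  extend : ∀ n {d} → Vec Bool d → Vec Bool (n ∸ d) → Vec Bool n
  extend n       []      w = w
  extend zero    (b ∷ x) w = []
  extend (suc n) (b ∷ x) w = b ∷ extend n x w

  extend-in-cube : ∀ n {d} (x : Vec Bool d) (w : Vec Bool (n ∸ d)) → d ≤ n →
                   Prefix (toList x) (extend n x w)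
  extend-in-cube n       []      w _         = tt
  extend-in-cube (suc n) (b ∷ x) w (s≤s d≤n) = refl , extend-in-cube n x w d≤n

  extend-onto : ∀ n {d} (x : Vec Bool d) (y : Vec Bool n) → Prefix (toList x) y →
                ∃ λ w → y ≡ extend n x w
  extend-onto n       []      y       _          = y , refl
  extend-onto (suc n) (b ∷ x) (.b ∷ y) (refl , pre) with extend-onto n x y pre
  ... | w , y≡ = w , cong (b ∷_) y≡

  allVecs : (a : ℕ) → List (Vec Bool a)
  allVecs zero    = [] ∷ []
  allVecs (suc a) = map (true ∷_) (allVecs a) ++ map (false ∷_) (allVecs a)

  length-allVecs : ∀ a → length (allVecs a) ≡ 2 ^ a
  length-allVecs zero    = refl
  length-allVecs (suc a) = begin
    length (map (true ∷_) (allVecs a) ++ map (false ∷_) (allVecs a))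
      ≡⟨ length-++ (map (true ∷_) (allVecs a)) ⟩
    length (map (true ∷_) (allVecs a)) + length (map (false ∷_) (allVecs a))
      ≡⟨ cong₂ _+_ (length-map (true ∷_) (allVecs a)) (length-map (false ∷_) (allVecs a)) ⟩
    length (allVecs a) + length (allVecs a)
      ≡⟨ cong₂ _+_ (length-allVecs a) (trans (length-allVecs a) (sym (ℕₚ.+-identityʳ (2 ^ a)))) ⟩
    2 ^ suc a ∎
    where open ≡-Reasoning

  ∈-allVecs : ∀ {a} (w : Vec Bool a) → w ∈ allVecs a
  ∈-allVecs []          = here refl
  ∈-allVecs (true  ∷ w) = ∈-++⁺ˡ (∈-map⁺ (true ∷_) (∈-allVecs w))
  ∈-allVecs {suc a} (false ∷ w) =
    ∈-++⁺ʳ (map (true ∷_) (allVecs a)) (∈-map⁺ (false ∷_) (∈-allVecs w))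

module Sums where

  open import Data.Nat using (ℕ; zero; suc; _+_; _*_; _≤_; _<_; z≤n; s≤s)
  import Data.Nat.Properties as ℕₚ
  open import Data.Nat.ListAction using (sum)
  open import Data.Nat.Tactic.RingSolver using (solve-∀)
  open import Data.Fin as Fin using (Fin; toℕ)
  open import Data.List using (tabulate)
  open import Function using (_∘_)
  open import Relation.Binary.PropositionalEquality

  sum-*ʳ : ∀ {k} (h : Fin k → ℕ) q → sum (tabulate (λ t → h t * q)) ≡ sum (tabulate h) * q
  sum-*ʳ {zero}  h q = refl
  sum-*ʳ {suc k} h q = trans (cong (h Fin.zero * q +_) (sum-*ʳ (h ∘ Fin.suc) q))
                             (sym (ℕₚ.*-distribʳ-+ q (h Fin.zero) _))

  sum-sparse : ∀ {k} (h : Fin k → ℕ) D X →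
    (∀ t → D ≤ toℕ t → h t ≡ 0) → (∀ t → toℕ t < D → h t ≤ X) → sum (tabulate h) ≤ D * X
  sum-sparse {zero}  h D       X vanish bounded = z≤n
  sum-sparse {suc k} h zero    X vanish bounded rewrite vanish Fin.zero z≤n =
    sum-sparse (h ∘ Fin.suc) zero X (λ t _ → vanish (Fin.suc t) z≤n) (λ t ())
  sum-sparse {suc k} h (suc D) X vanish bounded =
    ℕₚ.+-mono-≤ (bounded Fin.zero (s≤s z≤n))
                (sum-sparse (h ∘ Fin.suc) D X (λ t D≤t → vanish (Fin.suc t) (s≤s D≤t))
                                              (λ t t<D → bounded (Fin.suc t) (s≤s t<D)))

  averaging : ∀ {k} (h : Fin k → ℕ) D Y →
    (∀ t → D ≤ toℕ t → h t ≡ 0) → (∀ t → toℕ t < D → h t * D ≤ Y) → sum (tabulate h) ≤ Y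
  averaging h zero    Y vanish bounded =
    ℕₚ.≤-trans (sum-sparse h zero Y vanish λ t ()) z≤n
  averaging h (suc D) Y vanish bounded = ℕₚ.*-cancelʳ-≤ (sum (tabulate h)) Y (suc D) (begin
    sum (tabulate h) * suc D           ≡⟨ sum-*ʳ h (suc D) ⟨
    sum (tabulate (λ t → h t * suc D)) ≤⟨ sum-sparse _ (suc D) Y scaled-vanish bounded ⟩
    suc D * Y                          ≡⟨ ℕₚ.*-comm (suc D) Y ⟩
    Y * suc D                          ∎)
    where
    open ℕₚ.≤-Reasoning
    scaled-vanish : ∀ t → suc D ≤ toℕ t → h t * suc D ≡ 0
    scaled-vanish t D≤t rewrite vanish t D≤t = refl

  -- The counting at the heart of the greedy step, with γ = p / (q + 1):
  -- fewer than T used points plus a blue load F ≤ γ T stay below |S| = (1 + γ) T.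
  budget : ∀ c F s p q T → c < T → s * suc q ≡ (suc q + p) * T → F * suc q ≤ p * T → c + F < s
  budget c F s p q T c<T size load = ℕₚ.*-cancelʳ-< (suc q) (c + F) s (begin-strict
    (c + F) * suc q         ≡⟨ ℕₚ.*-distribʳ-+ (suc q) c F ⟩
    c * suc q + F * suc q   <⟨ ℕₚ.+-mono-<-≤ (ℕₚ.*-monoˡ-< (suc q) c<T) load ⟩
    T * suc q + p * T       ≡⟨ regroup T (suc q) p ⟩
    (suc q + p) * T         ≡⟨ size ⟨
    s * suc q               ∎)
    where
    open ℕₚ.≤-Reasoning
    regroup : ∀ T Q p → T * Q + p * T ≡ (Q + p) * T
    regroup = solve-∀

module RationalConditions where

  open import Defs using (fromℕ)
  open import Data.Nat as ℕ using (ℕ; suc)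
  import Data.Nat.Properties as ℕₚ
  open import Data.Nat.Coprimality using (Coprime; 1-coprimeTo) renaming (sym to coprime-sym)
  open import Data.Integer as ℤ using (ℤ; +_)
  import Data.Integer.Properties as ℤₚ
  open import Data.Integer.Tactic.RingSolver using (solve-∀)
  open import Data.Rational as ℚ using (ℚ; mkℚ; toℚᵘ; 1ℚ)
  import Data.Rational.Properties as ℚₚ
  import Data.Rational.Unnormalised as ℚᵘ
  import Data.Rational.Unnormalised.Properties as ℚᵘₚ
  open import Relation.Binary.PropositionalEquality

  -- Each condition is moved to unnormalised rationals, where ≡ and ≤ are
  -- cross-multiplications in ℤ, and then normalised by the ring solver.

  natℚ : ℕ → ℚ
  natℚ a = mkℚ (+ a) 0 (coprime-sym (1-coprimeTo a))

  fromℕ-normal : ∀ a → fromℕ a ≡ natℚ a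
  fromℕ-normal a = ℚₚ.normalize-coprime (coprime-sym (1-coprimeTo a))

  module Fraction (p q : ℕ) .(c : Coprime p (suc q)) where

    γ : ℚ
    γ = mkℚ (+ p) q c

    size-in-ℕ : ∀ s b → fromℕ s ≡ (1ℚ ℚ.+ γ) ℚ.* fromℕ b → s ℕ.* suc q ≡ (suc q ℕ.+ p) ℕ.* b
    size-in-ℕ s b eq rewrite fromℕ-normal s | fromℕ-normal b
      with ℚᵘ.*≡* cross ← ℚᵘₚ.≃-trans (ℚₚ.toℚᵘ-cong eq)
             (ℚᵘₚ.≃-trans (ℚₚ.toℚᵘ-homo-* (1ℚ ℚ.+ γ) (natℚ b))
                          (ℚᵘₚ.*-congʳ (ℚₚ.toℚᵘ-homo-+ 1ℚ γ)))
      = ℤₚ.+-injective (begin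
        + (s ℕ.* suc q)                                        ≡⟨ ℤₚ.pos-* s (suc q) ⟩
        + s ℤ.* + suc q                                        ≡⟨ cong (λ k → + s ℤ.* + k) unit ⟨
        + s ℤ.* + ((1 ℕ.* suc q) ℕ.* 1)                        ≡⟨ cross ⟩
        ((+ 1 ℤ.* + suc q ℤ.+ + p ℤ.* + 1) ℤ.* + b) ℤ.* + 1    ≡⟨ normalise (+ suc q) (+ p) (+ b) ⟩
        (+ suc q ℤ.+ + p) ℤ.* + b                              ≡⟨ cong (ℤ._* + b) (ℤₚ.pos-+ (suc q) p) ⟨
        + (suc q ℕ.+ p) ℤ.* + b                                ≡⟨ ℤₚ.pos-* (suc q ℕ.+ p) b ⟨
        + ((suc q ℕ.+ p) ℕ.* b)                                ∎)
      where
      open ≡-Reasoning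
      unit : (1 ℕ.* suc q) ℕ.* 1 ≡ suc q
      unit = trans (ℕₚ.*-identityʳ _) (ℕₚ.*-identityˡ _)
      normalise : ∀ (Q P B : ℤ) → ((+ 1 ℤ.* Q ℤ.+ P ℤ.* + 1) ℤ.* B) ℤ.* + 1 ≡ (Q ℤ.+ P) ℤ.* B
      normalise = solve-∀

    load-in-ℕ : ∀ a b → fromℕ a ℚ.≤ γ ℚ.* fromℕ b → a ℕ.* suc q ℕ.≤ p ℕ.* b
    load-in-ℕ a b le rewrite fromℕ-normal a | fromℕ-normal b
      with ℚᵘ.*≤* cross ← ℚᵘₚ.≤-respʳ-≃ (ℚₚ.toℚᵘ-homo-* γ (natℚ b)) (ℚₚ.toℚᵘ-mono-≤ le)
      = ℤₚ.drop‿+≤+ (subst₂ ℤ._≤_ lhs rhs cross)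
      where
      lhs : + a ℤ.* + (suc q ℕ.* 1) ≡ + (a ℕ.* suc q)
      lhs = trans (cong (λ k → + a ℤ.* + k) (ℕₚ.*-identityʳ _)) (sym (ℤₚ.pos-* a (suc q)))
      rhs : (+ p ℤ.* + b) ℤ.* + 1 ≡ + (p ℕ.* b)
      rhs = trans (ℤₚ.*-identityʳ _) (sym (ℤₚ.pos-* p b))

    host-in-ℕ : ∀ b M → (1ℚ ℚ.+ fromℕ 3 ℚ.* γ) ℚ.* fromℕ b ℚ.≤ fromℕ M →
                (suc q ℕ.+ 3 ℕ.* p) ℕ.* b ℕ.≤ M ℕ.* suc q
    host-in-ℕ b M le rewrite fromℕ-normal b | fromℕ-normal M
      with ℚᵘ.*≤* cross ←
        ℚᵘₚ.≤-respˡ-≃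
          (ℚᵘₚ.≃-trans (ℚₚ.toℚᵘ-homo-* (1ℚ ℚ.+ fromℕ 3 ℚ.* γ) (natℚ b))
            (ℚᵘₚ.*-congʳ (ℚᵘₚ.≃-trans (ℚₚ.toℚᵘ-homo-+ 1ℚ (fromℕ 3 ℚ.* γ))
                                     (ℚᵘₚ.+-congʳ (toℚᵘ 1ℚ) (ℚₚ.toℚᵘ-homo-* (fromℕ 3) γ)))))
          (ℚₚ.toℚᵘ-mono-≤ le)
      = ℤₚ.drop‿+≤+ (subst₂ ℤ._≤_ lhs rhs cross)
      where
      normalise : ∀ (Q P B : ℤ) →
                  ((+ 1 ℤ.* Q ℤ.+ (+ 3 ℤ.* P) ℤ.* + 1) ℤ.* B) ℤ.* + 1 ≡ (Q ℤ.+ + 3 ℤ.* P) ℤ.* B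
      normalise = solve-∀
      lhs : ((+ 1 ℤ.* + (1 ℕ.* suc q) ℤ.+ (+ 3 ℤ.* + p) ℤ.* + 1) ℤ.* + b) ℤ.* + 1 ≡
            + ((suc q ℕ.+ 3 ℕ.* p) ℕ.* b)
      lhs = begin
        ((+ 1 ℤ.* + (1 ℕ.* suc q) ℤ.+ (+ 3 ℤ.* + p) ℤ.* + 1) ℤ.* + b) ℤ.* + 1
          ≡⟨ cong (λ k → ((+ 1 ℤ.* + k ℤ.+ (+ 3 ℤ.* + p) ℤ.* + 1) ℤ.* + b) ℤ.* + 1)
                  (ℕₚ.*-identityˡ (suc q)) ⟩
        ((+ 1 ℤ.* + suc q ℤ.+ (+ 3 ℤ.* + p) ℤ.* + 1) ℤ.* + b) ℤ.* + 1
          ≡⟨ normalise (+ suc q) (+ p) (+ b) ⟩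
        (+ suc q ℤ.+ + 3 ℤ.* + p) ℤ.* + b
          ≡⟨ cong (λ k → (+ suc q ℤ.+ k) ℤ.* + b) (ℤₚ.pos-* 3 p) ⟨
        (+ suc q ℤ.+ + (3 ℕ.* p)) ℤ.* + b
          ≡⟨ cong (ℤ._* + b) (ℤₚ.pos-+ (suc q) (3 ℕ.* p)) ⟨
        + (suc q ℕ.+ 3 ℕ.* p) ℤ.* + b
          ≡⟨ ℤₚ.pos-* (suc q ℕ.+ 3 ℕ.* p) b ⟨
        + ((suc q ℕ.+ 3 ℕ.* p) ℕ.* b) ∎
        where open ≡-Reasoning
      unit : (1 ℕ.* (1 ℕ.* suc q)) ℕ.* 1 ≡ suc q
      unit = trans (ℕₚ.*-identityʳ _) (trans (ℕₚ.*-identityˡ _) (ℕₚ.*-identityˡ _))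
      rhs : + M ℤ.* + ((1 ℕ.* (1 ℕ.* suc q)) ℕ.* 1) ≡ + (M ℕ.* suc q)
      rhs = trans (cong (λ k → + M ℤ.* + k) unit) (sym (ℤₚ.pos-* M (suc q)))

module Greedy where

  open import Defs
  open AvoidingSets
  open Subcubes
  open Sums
  open import Data.Bool as Bool using (Bool; true; false)
  open import Data.Nat using (ℕ; suc; _+_; _*_; _≤_; _<_; z≤n; s≤s; _∸_; _^_)
  import Data.Nat.Properties as ℕₚ
  open import Data.Fin as Fin using (Fin; toℕ)
  import Data.Fin.Properties as Finₚ
  open import Data.Fin.Subset using (Subset; _∈_; _∉_; _∩_; ∣_∣; ⁅_⁆) renaming (⊥ to ∅)
  open import Data.Fin.Subset.Properties using (∣p∩q∣≤∣p∣; ∣⊥∣≡0; ∣⁅x⁆∣≡1; x∉⁅y⁆⇒x≢y; ∩-zeroˡ)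
  open import Data.Vec as Vec using (Vec; toList)
  import Data.Vec.Properties as Vecₚ
  open import Data.List as List using (List; []; _∷_; map; _++_; length)
  import Data.List.Properties as Listₚ
  open import Data.Nat.ListAction using (sum)
  open import Data.Nat.Tactic.RingSolver using (solve-∀)
  open import Data.List.Membership.Propositional using () renaming (_∈_ to _∈ᴸ_)
  open import Data.List.Relation.Unary.Any using (here; there)
  open import Data.List.Membership.Propositional.Properties using (∈-map⁺; ∈-allFin)
  open import Data.List.Relation.Unary.AllPairs using (AllPairs; []; _∷_)
  import Data.List.Relation.Unary.AllPairs.Properties as AllPairsₚ
  open import Data.List.Relation.Unary.All as All using (All; []; _∷_)
  import Data.List.Relation.Unary.All.Properties as Allₚ
  open import Data.Maybe using (Maybe; just; nothing)
  open import Data.Rational using (ℚ)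
  open import Data.Product using (Σ; ∃; _×_; _,_; proj₁; proj₂)
  open import Data.Sum using (_⊎_; inj₁; inj₂)
  open import Data.Empty using (⊥-elim)
  open import Relation.Nullary using (yes; no)
  open import Relation.Binary.PropositionalEquality
  open import Function using (id; _∘_; case_of_)

  module BlueNeighbourhoods {M : ℕ} (H : TwoColouring M) where
    open TwoColouring H

    ∈NB⇒blue : ∀ u v → v ∈ NB H u → u ≢ v × blue u v ≡ true
    ∈NB⇒blue u v v∈NB with trans (sym (Vecₚ.lookup∘tabulate _ v)) (Vecₚ.[]=⇒lookup v∈NB)
    ... | entry with u Fin.≟ v
    ∈NB⇒blue u v v∈NB | () | yes _
    ∈NB⇒blue u v v∈NB | entry | no u≢v = u≢v , entry

    blue⇒∈NB : ∀ u v → u ≢ v → blue u v ≡ true → v ∈ NB H u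
    blue⇒∈NB u v u≢v uv-blue = Vecₚ.lookup⇒[]= v (NB H u) (entry (Vec.lookup (NB H u) v) refl)
      where
      entry : ∀ b → Vec.lookup (NB H u) v ≡ b → Vec.lookup (NB H u) v ≡ true
      entry true  is-true = is-true
      entry false is-false with trans (sym (Vecₚ.lookup∘tabulate _ v)) is-false
      ... | distinct-false with u Fin.≟ v
      ... | yes u≡v = ⊥-elim (u≢v u≡v)
      ... | no _    with trans (sym uv-blue) distinct-false
      ... | ()

    ∉NB⇒red : ∀ u v → u ≢ v → v ∉ NB H u → blue v u ≡ false
    ∉NB⇒red u v u≢v v∉NB with blue u v in uv
    ... | true  = ⊥-elim (v∉NB (blue⇒∈NB u v u≢v uv))
    ... | false = trans (blueSym v u) uv

    clique-load : ∀ S u → RedClique H S → u ∈ S → ∣ NB H u ∩ S ∣ ≡ 0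
    clique-load S u red u∈S = disjoint⇒∣∩∣≡0 (NB H u) S λ v v∈S v∈NB →
      let u≢v , uv-blue = ∈NB⇒blue u v v∈NB in
      case trans (sym uv-blue) (red u v u∈S v∈S u≢v) of λ ()

  module _ {γ : ℚ} {n M m : ℕ} {H : TwoColouring M} (A : PartialAssignment γ n H m) where
    open PartialAssignment A

    SizeCondition : ℕ → ℕ → Set
    SizeCondition p q = ∀ i → ∣ S i ∣ * suc q ≡ (suc q + p) * 2 ^ (n ∸ d i)

    SparseCondition : ℕ → ℕ → Set
    SparseCondition p q = ∀ i j → i Fin.< j → toList (x i) ∼ toList (x j) → ∀ v → v ∈ S j →
                          (∣ NB H v ∩ S i ∣ * d i) * suc q ≤ p * 2 ^ (n ∸ d i)

  -- The greedy embedding of ⋃ᵢ Q_{xᵢ}, built as a table of placed vertices.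
  -- `default` is an arbitrary vertex of H, used only where no choice is needed.
  module GreedyEmbedding {γ : ℚ} {n M m : ℕ} {H : TwoColouring M} (A : PartialAssignment γ n H m)
                         (default : Fin M) where
    open PartialAssignment A
    open TwoColouring H
    open BlueNeighbourhoods H

    -- An entry (c , y , u) records that the vertex y of the subcube Q_{x c} is sent to u.
    Entry : Set
    Entry = Fin m × Vec Bool n × Fin M

    -- A table lists the placements made so far, the most recent first.
    Table : Set
    Table = List Entry

    label : Entry → Fin m
    label = proj₁

    assigned : Table → Vec Bool n → Maybe (Fin m × Fin M)
    assigned []                z = nothing
    assigned ((c , y , u) ∷ L) z with Vecₚ.≡-dec Bool._≟_ y z
    ... | yes _ = just (c , u)
    ... | no  _ = assigned L z

    _∋_↦_ : Table → Vec Bool n → Fin m × Fin M → Set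
    L ∋ z ↦ cu = assigned L z ≡ just cu

    ↦-∷⁻ : ∀ c y u L z {cu} → ((c , y , u) ∷ L) ∋ z ↦ cu → (y ≡ z × cu ≡ (c , u)) ⊎ L ∋ z ↦ cu
    ↦-∷⁻ c y u L z found with Vecₚ.≡-dec Bool._≟_ y z
    ↦-∷⁻ c y u L z refl  | yes y≡z = inj₁ (y≡z , refl)
    ↦-∷⁻ c y u L z found | no  _   = inj₂ found

    ↦-∈ : ∀ L {z c u} → L ∋ z ↦ (c , u) → (c , z , u) ∈ᴸ L
    ↦-∈ ((c' , y , u') ∷ L) {z} found with Vecₚ.≡-dec Bool._≟_ y z
    ↦-∈ ((c' , y , u') ∷ L) refl | yes refl = here refl
    ↦-∈ ((c' , y , u') ∷ L) found | no _     = there (↦-∈ L found)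

    Placed : Table → Vec Bool n → Set
    Placed L z = ∃ (L ∋ z ↦_)

    Placed-∷ : ∀ e L z → Placed L z → Placed (e ∷ L) z
    Placed-∷ (c , y , u) L z (cu , found) with Vecₚ.≡-dec Bool._≟_ y z
    ... | yes _ = (c , u) , refl
    ... | no  _ = cu , found

    Placed-new : ∀ c y u L → Placed ((c , y , u) ∷ L) y
    Placed-new c y u L with Vecₚ.≡-dec Bool._≟_ y y
    ... | yes _   = (c , u) , refl
    ... | no  y≢y = ⊥-elim (y≢y refl)

    record Valid (L : Table) : Set where
      field
        placed    : ∀ {z c u} → L ∋ z ↦ (c , u) → Prefix (toList (x c)) z × u ∈ S c
        injective : ∀ {z z' c c' u u'} → L ∋ z ↦ (c , u) → L ∋ z' ↦ (c' , u') → z ≢ z' → u ≢ u'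
        red-edges : ∀ {z z' c c' u u'} → L ∋ z ↦ (c , u) → L ∋ z' ↦ (c' , u') → CubeEdge z z' →
                    blue u u' ≡ false

    valid-[] : Valid []
    valid-[] = record { placed = λ () ; injective = λ () ; red-edges = λ () }

    used : Table → Fin m → List (Subset M)
    used []                 c = []
    used ((c' , _ , u) ∷ L) c with c' Fin.≟ c
    ... | yes _ = ⁅ u ⁆ ∷ used L c
    ... | no  _ = used L c

    usedCount : Table → Fin m → ℕ
    usedCount L c = length (used L c)

    used-∈ : ∀ L {c z u} → (c , z , u) ∈ᴸ L → ⁅ u ⁆ ∈ᴸ used L c
    used-∈ ((c' , _ , _) ∷ L) {c} (here refl) with c' Fin.≟ c
    ... | yes _    = here refl
    ... | no  c≢c  = ⊥-elim (c≢c refl)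
    used-∈ ((c' , _ , _) ∷ L) {c} (there e∈L) with c' Fin.≟ c
    ... | yes _ = there (used-∈ L e∈L)
    ... | no  _ = used-∈ L e∈L

    blueOf : Maybe (Fin m × Fin M) → Subset M
    blueOf (just (_ , u)) = NB H u
    blueOf nothing        = ∅

    blocked : Table → Fin m → Vec Bool n → List (Subset M)
    blocked L c y = used L c ++ List.tabulate (λ t → blueOf (assigned L (flipAt t y)))

    module Extend {L : Table} {c : Fin m} {y : Vec Bool n} {u : Fin M} (valid : Valid L)
                  (y∈Q : Prefix (toList (x c)) y) (avoids : Avoids (S c) (blocked L c y) u) where
      open Valid valid

      u∈S : u ∈ S c
      u∈S = proj₁ avoids

      -- u is a new image: it avoids the images used in S c, and the other
      -- images lie in the sets S c' disjoint from S c.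
      fresh : ∀ {z c' u'} → L ∋ z ↦ (c' , u') → u ≢ u'
      fresh {z} {c'} {u'} found with c' Fin.≟ c
      ... | yes refl =
        x∉⁅y⁆⇒x≢y (All.lookup (Allₚ.++⁻ˡ (used L c) (proj₂ avoids)) (used-∈ L (↦-∈ L found)))
      ... | no  c'≢c = λ { refl → S-disj c c' (c'≢c ∘ sym) u u∈S (proj₂ (placed found)) }

      not-blue : ∀ {z c' u'} → L ∋ z ↦ (c' , u') → CubeEdge y z → blue u u' ≡ false
      not-blue {z} found edge with CubeEdge⇒flip y z edge
      ... | t , refl = ∉NB⇒red _ u (fresh found ∘ sym)
                         (subst (u ∉_) (cong blueOf found)
                                (Allₚ.tabulate⁻ (Allₚ.++⁻ʳ (used L c) (proj₂ avoids)) t))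

      valid-∷ : Valid ((c , y , u) ∷ L)
      valid-∷ = record { placed = placed′ ; injective = injective′ ; red-edges = red-edges′ }
        where
        placed′ : ∀ {z c₁ u₁} → ((c , y , u) ∷ L) ∋ z ↦ (c₁ , u₁) →
                  Prefix (toList (x c₁)) z × u₁ ∈ S c₁
        placed′ {z} found with ↦-∷⁻ c y u L z found
        ... | inj₁ (refl , refl) = y∈Q , u∈S
        ... | inj₂ old           = placed old

        injective′ : ∀ {z z' c₁ c₁' u₁ u₁'} → ((c , y , u) ∷ L) ∋ z ↦ (c₁ , u₁) →
                     ((c , y , u) ∷ L) ∋ z' ↦ (c₁' , u₁') → z ≢ z' → u₁ ≢ u₁'
        injective′ {z} {z'} found found' z≢z' with ↦-∷⁻ c y u L z found | ↦-∷⁻ c y u L z' found'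
        ... | inj₁ (refl , refl) | inj₁ (refl , refl) = ⊥-elim (z≢z' refl)
        ... | inj₁ (refl , refl) | inj₂ old'          = fresh old'
        ... | inj₂ old           | inj₁ (refl , refl) = fresh old ∘ sym
        ... | inj₂ old           | inj₂ old'          = injective old old' z≢z'

        red-edges′ : ∀ {z z' c₁ c₁' u₁ u₁'} → ((c , y , u) ∷ L) ∋ z ↦ (c₁ , u₁) →
                     ((c , y , u) ∷ L) ∋ z' ↦ (c₁' , u₁') → CubeEdge z z' → blue u₁ u₁' ≡ false
        red-edges′ {z} {z'} found found' edge with ↦-∷⁻ c y u L z found | ↦-∷⁻ c y u L z' found'
        ... | inj₁ (refl , refl) | inj₁ (refl , refl) = ⊥-elim (CubeEdge-irrefl z edge)
        ... | inj₁ (refl , refl) | inj₂ old'          = not-blue old' edge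
        ... | inj₂ old           | inj₁ (refl , refl) =
          trans (blueSym _ u) (not-blue old (CubeEdge-sym z z' edge))
        ... | inj₂ old           | inj₂ old'          = red-edges old old' edge

    placement : Fin m → Vec Bool n → Table → Entry
    placement c y L = c , y , choose default (S c) (blocked L c y)

    place : Fin m → Vec Bool n → Table → Table
    place c y L = placement c y L ∷ L

    placeAll : Fin m → List (Vec Bool n) → Table → Table
    placeAll c []       L = L
    placeAll c (y ∷ ys) L = placeAll c ys (place c y L)

    placeAll-labels : ∀ (P : Fin m → Set) c ys L → P c → All (P ∘ label) L →
                      All (P ∘ label) (placeAll c ys L)
    placeAll-labels P c []       L _  labels = labels
    placeAll-labels P c (y ∷ ys) L Pc labels = placeAll-labels P c ys (place c y L) Pc (Pc ∷ labels)

    placeAll-keeps : ∀ c ys L z → Placed L z → Placed (placeAll c ys L) z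
    placeAll-keeps c []       L z placed = placed
    placeAll-keeps c (y ∷ ys) L z placed =
      placeAll-keeps c ys (place c y L) z (Placed-∷ (placement c y L) L z placed)

    placeAll-covers : ∀ c ys L z → z ∈ᴸ ys → Placed (placeAll c ys L) z
    placeAll-covers c (y ∷ ys) L z (here refl)  =
      placeAll-keeps c ys (place c y L) z (Placed-new c y _ L)
    placeAll-covers c (y ∷ ys) L z (there z∈ys) = placeAll-covers c ys (place c y L) z z∈ys

    usedCount-place : ∀ c y L → usedCount (place c y L) c ≡ suc (usedCount L c)
    usedCount-place c y L with c Fin.≟ c
    ... | yes _   = refl
    ... | no  c≢c = ⊥-elim (c≢c refl)

    usedCount-later : ∀ c L → All (λ e → c Fin.< label e) L → usedCount L c ≡ 0
    usedCount-later c []                 []            = refl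
    usedCount-later c ((c' , _ , _) ∷ L) (c<c' ∷ later) with c' Fin.≟ c
    ... | yes refl = ⊥-elim (ℕₚ.<-irrefl refl c<c')
    ... | no  _    = usedCount-later c L later

    cubeVertices : Fin m → List (Vec Bool n)
    cubeVertices c = map (extend n (x c)) (allVecs (n ∸ d c))

    cubeVertices-in : ∀ c → All (Prefix (toList (x c))) (cubeVertices c)
    cubeVertices-in c = Allₚ.map⁺ (All.tabulate λ {w} _ → extend-in-cube n (x c) w (d≤n c))

    length-cubeVertices : ∀ c → length (cubeVertices c) ≡ 2 ^ (n ∸ d c)
    length-cubeVertices c =
      trans (Listₚ.length-map (extend n (x c)) (allVecs (n ∸ d c))) (length-allVecs (n ∸ d c))

    fillCubes : List (Fin m) → Table
    fillCubes []       = []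
    fillCubes (c ∷ cs) = placeAll c (cubeVertices c) (fillCubes cs)

    fillCubes-labels : ∀ cs → All (λ e → label e ∈ᴸ cs) (fillCubes cs)
    fillCubes-labels []       = []
    fillCubes-labels (c ∷ cs) =
      placeAll-labels (_∈ᴸ c ∷ cs) c (cubeVertices c) (fillCubes cs)
                      (here refl) (All.map there (fillCubes-labels cs))

    fillCubes-covers : ∀ cs {c} → c ∈ᴸ cs → ∀ z → Prefix (toList (x c)) z →
                       Placed (fillCubes cs) z
    fillCubes-covers (c ∷ cs) (here refl) z z∈Q with extend-onto n (x c) z z∈Q
    ... | w , refl =
      placeAll-covers c (cubeVertices c) (fillCubes cs) _ (∈-map⁺ (extend n (x c)) (∈-allVecs w))
    fillCubes-covers (c' ∷ cs) (there c∈cs) z z∈Q =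
      placeAll-keeps c' (cubeVertices c') (fillCubes cs) z (fillCubes-covers cs c∈cs z z∈Q)

    -- The final table embeds all subcubes, in decreasing order of index.
    table : Table
    table = fillCubes (List.allFin m)

    -- The embedding read off the table (arbitrary off ⋃ᵢ Q_{xᵢ}).
    image : Maybe (Fin m × Fin M) → Fin M
    image (just (_ , u)) = u
    image nothing        = default

    φ : Vec Bool n → Fin M
    φ y = image (assigned table y)

    placed-in-table : ∀ i y → InCube y (x i) → Placed table y
    placed-in-table i y y∈Q =
      fillCubes-covers (List.allFin m) (∈-allFin i) y (InCube⇒Prefix y (x i) y∈Q)

    Above : Fin m → Table → Set
    Above c L = All (λ e → c Fin.≤ label e) L

    module Counting (p q : ℕ) (size : SizeCondition A p q) (sparse : SparseCondition A p q) where

      load-used : ∀ S' L c → load S' (used L c) ≤ usedCount L c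
      load-used S' []                 c = z≤n
      load-used S' ((c' , _ , u) ∷ L) c with c' Fin.≟ c
      ... | yes _ = ℕₚ.+-mono-≤ (ℕₚ.≤-trans (∣p∩q∣≤∣p∣ ⁅ u ⁆ S') (ℕₚ.≤-reflexive (∣⁅x⁆∣≡1 u)))
                                (load-used S' L c)
      ... | no  _ = load-used S' L c

      module Neighbours {L : Table} {c : Fin m} {y : Vec Bool n} (valid : Valid L) (above : Above c L)
                        (y∈Q : Prefix (toList (x c)) y) where
        open Valid valid

        T : ℕ
        T = 2 ^ (n ∸ d c)

        blockedBy : Fin n → ℕ
        blockedBy t = ∣ blueOf (assigned L (flipAt t y)) ∩ S c ∣

        -- A neighbour blocks nothing unless it lies in an adjacent later subcube,
        -- across one of the d c fixed coordinates.
        neighbour : ∀ t → blockedBy t ≡ 0 ⊎ (toℕ t < d c × (blockedBy t * d c) * suc q ≤ p * T)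
        neighbour t with assigned L (flipAt t y) in found
        ... | nothing = inj₁ (trans (cong ∣_∣ (∩-zeroˡ (S c))) (∣⊥∣≡0 M))
        ... | just (c' , u') with placed found | c' Fin.≟ c
        ... | _ , u'∈S | yes refl = inj₁ (clique-load (S c) u' (S-red c) u'∈S)
        ... | flip∈Q' , u'∈S | no c'≢c
          with edge-between-subcubes (toList (x c)) (toList (x c')) t y y∈Q flip∈Q'
        ... | inj₁ flip∈Q =
          ⊥-elim (Q-disj c c' (c'≢c ∘ sym) (flipAt t y)
                         (Prefix⇒InCube _ (x c) flip∈Q) (Prefix⇒InCube _ (x c') flip∈Q'))
        ... | inj₂ (inj₁ y∈Q') =
          ⊥-elim (Q-disj c c' (c'≢c ∘ sym) y (Prefix⇒InCube y (x c) y∈Q) (Prefix⇒InCube y (x c') y∈Q'))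
        ... | inj₂ (inj₂ (adjacent , t<d)) =
          inj₂ (subst (toℕ t <_) (Vecₚ.length-toList (x c)) t<d , sparse c c' c<c' adjacent u' u'∈S)
          where
          c<c' : c Fin.< c'
          c<c' = Finₚ.≤∧≢⇒< (All.lookup above (↦-∈ L found)) (c'≢c ∘ sym)

        neighbours-load : sum (List.tabulate blockedBy) * suc q ≤ p * T
        neighbours-load = subst (_≤ p * T) (sum-*ʳ blockedBy (suc q))
          (averaging (λ t → blockedBy t * suc q) (d c) (p * T) vanish bounded)
          where
          vanish : ∀ t → d c ≤ toℕ t → blockedBy t * suc q ≡ 0
          vanish t d≤t with neighbour t
          ... | inj₁ none        = cong (_* suc q) none
          ... | inj₂ (t<d , _)   = ⊥-elim (ℕₚ.<⇒≱ t<d d≤t)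
          rearrange : ∀ a b c → (a * b) * c ≡ (a * c) * b
          rearrange = solve-∀
          bounded : ∀ t → toℕ t < d c → (blockedBy t * suc q) * d c ≤ p * T
          bounded t _ with neighbour t
          ... | inj₁ none rewrite none = z≤n
          ... | inj₂ (_ , bound) = subst (_≤ p * T) (rearrange (blockedBy t) (d c) (suc q)) bound

      blocked-load : ∀ {L c y} → Valid L → Above c L → Prefix (toList (x c)) y →
        usedCount L c < 2 ^ (n ∸ d c) → load (S c) (blocked L c y) < ∣ S c ∣
      blocked-load {L} {c} {y} valid above y∈Q few = ℕₚ.≤-<-trans split
        (budget (usedCount L c) (sum (List.tabulate blockedBy)) ∣ S c ∣ p q T few (size c) neighbours-load)
        where
        open Neighbours valid above y∈Q
        open ℕₚ.≤-Reasoning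
        neighbourSet : Fin n → Subset M
        neighbourSet t = blueOf (assigned L (flipAt t y))
        split : load (S c) (blocked L c y) ≤ usedCount L c + sum (List.tabulate blockedBy)
        split = begin
          load (S c) (blocked L c y)
            ≡⟨ load-++ (S c) (used L c) (List.tabulate neighbourSet) ⟩
          load (S c) (used L c) + load (S c) (List.tabulate neighbourSet)
            ≤⟨ ℕₚ.+-monoˡ-≤ _ (load-used (S c) L c) ⟩
          usedCount L c + load (S c) (List.tabulate neighbourSet)
            ≡⟨ cong (λ ns → usedCount L c + sum ns)
                    (Listₚ.map-tabulate neighbourSet (λ B → ∣ B ∩ S c ∣)) ⟩
          usedCount L c + sum (List.tabulate blockedBy) ∎

      placeAll-valid : ∀ c ys L → Valid L → Above c L → All (Prefix (toList (x c))) ys →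
        usedCount L c + length ys ≤ 2 ^ (n ∸ d c) → Valid (placeAll c ys L)
      placeAll-valid c []       L valid _     _              _    = valid
      placeAll-valid c (y ∷ ys) L valid above (y∈Q ∷ ys∈Q) room =
        placeAll-valid c ys (place c y L) (Extend.valid-∷ valid y∈Q avoids)
                       (Finₚ.≤-refl ∷ above) ys∈Q room′
        where
        room″ : suc (usedCount L c + length ys) ≤ 2 ^ (n ∸ d c)
        room″ = subst (_≤ 2 ^ (n ∸ d c)) (ℕₚ.+-suc (usedCount L c) (length ys)) room
        avoids : Avoids (S c) (blocked L c y) (choose default (S c) (blocked L c y))
        avoids = choose-avoids default (S c) (blocked L c y)
                   (blocked-load valid above y∈Q (ℕₚ.≤-trans (s≤s (ℕₚ.m≤m+n _ _)) room″))
        room′ : usedCount (place c y L) c + length ys ≤ 2 ^ (n ∸ d c)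
        room′ = subst (λ k → k + length ys ≤ 2 ^ (n ∸ d c)) (sym (usedCount-place c y L)) room″

      fillCubes-valid : ∀ cs → AllPairs Fin._<_ cs → Valid (fillCubes cs)
      fillCubes-valid []       []               = valid-[]
      fillCubes-valid (c ∷ cs) (c<cs ∷ sorted) =
        placeAll-valid c (cubeVertices c) (fillCubes cs) (fillCubes-valid cs sorted)
                       (All.map ℕₚ.<⇒≤ later) (cubeVertices-in c) room
        where
        later : All (λ e → c Fin.< label e) (fillCubes cs)
        later = All.map (All.lookup c<cs) (fillCubes-labels cs)
        room : usedCount (fillCubes cs) c + length (cubeVertices c) ≤ 2 ^ (n ∸ d c)
        room = ℕₚ.≤-reflexive (cong₂ _+_ (usedCount-later c (fillCubes cs) later) (length-cubeVertices c))

      embedding : GoodEmbedding A φ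
      embedding = record { inj = injective′ ; red = red′ ; inS = inS′ }
        where
        open Valid (fillCubes-valid (List.allFin m) (AllPairsₚ.tabulate⁺-< id))
        injective′ : ∀ y y' → ∃ (λ i → InCube y (x i)) → ∃ (λ i → InCube y' (x i)) →
                     φ y ≡ φ y' → y ≡ y'
        injective′ y y' (i , y∈Q) (i' , y'∈Q) same
          with placed-in-table i y y∈Q | placed-in-table i' y' y'∈Q
        ... | _ , found | _ , found' with Vecₚ.≡-dec Bool._≟_ y y'
        ... | yes y≡y' = y≡y'
        ... | no  y≢y' rewrite found | found' = ⊥-elim (injective found found' y≢y' same)
        red′ : ∀ y y' → ∃ (λ i → InCube y (x i)) → ∃ (λ i → InCube y' (x i)) →
               CubeEdge y y' → blue (φ y) (φ y') ≡ false
        red′ y y' (i , y∈Q) (i' , y'∈Q) edge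
          with placed-in-table i y y∈Q | placed-in-table i' y' y'∈Q
        ... | _ , found | _ , found' rewrite found | found' = red-edges found found' edge
        inS′ : ∀ i y → InCube y (x i) → φ y ∈ S i
        inS′ i y y∈Q with placed-in-table i y y∈Q
        ... | (c , u) , found with placed found | c Fin.≟ i
        ... | _    , u∈S | yes refl = subst (_∈ S c) (sym (cong image found)) u∈S
        ... | y∈Q′ , _   | no  c≢i  = ⊥-elim (Q-disj c i c≢i y (Prefix⇒InCube y (x c) y∈Q′) y∈Q)
  greedy-embedding : ∀ {γ n M m} {H : TwoColouring M} (A : PartialAssignment γ n H m) → Fin M →
    ∀ p q → SizeCondition A p q → SparseCondition A p q → Σ (Vec Bool n → Fin M) (GoodEmbedding A)
  greedy-embedding A default p q size sparse = φ , Counting.embedding p q size sparse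
    where open GreedyEmbedding A default



open import Defs
open import Data.Nat using (ℕ; _≥_; _^_)
open import Data.Rational using (ℚ; 0ℚ; 1ℚ; _<_; _≤_; _+_; _*_; _/_)
open import Data.Integer using (+_)
open import Data.Product using (∃; Σ)
open import Data.Fin using (Fin)
open import Data.Vec using (Vec)
open import Data.Bool using (Bool)

import Data.Nat as ℕ
import Data.Nat.Properties as ℕₚ
open import Data.Integer using (-[1+_])
open import Data.Rational using (mkℚ; *<*)
open import Data.Fin.Subset using (∣_∣; _∩_)
open import Data.Product using (_,_)
open import Data.Empty using (⊥-elim)
open import Data.Nat.Coprimality using (Coprime)
import Data.Fin
open RationalConditions
open Greedy

module _ (p q : ℕ) .(c : Coprime p (ℕ.suc q)) where
  open Fraction p q c

  size-condition : ∀ {n M m} {H : TwoColouring M} (A : PartialAssignment γ n H m) → SizeCondition A p q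
  size-condition {n} A i = size-in-ℕ ∣ S i ∣ (2 ^ (n ℕ.∸ d i)) (S-size i)
    where open PartialAssignment A

  sparse-condition : ∀ {n M m} {H : TwoColouring M} (A : PartialAssignment γ n H m) → SparseCondition A p q
  sparse-condition {n} {H = H} A i j i<j adjacent v v∈S =
    load-in-ℕ (∣ NB H v ∩ S i ∣ ℕ.* d i) (2 ^ (n ℕ.∸ d i)) (blueBd i j i<j adjacent v v∈S)
    where open PartialAssignment A

  -- H has a vertex, since it has at least (1 + 3γ) 2^n > 0 of them.
  host-vertex : ∀ n M → (1ℚ + fromℕ 3 * γ) * fromℕ (2 ^ n) ≤ fromℕ M → Fin M
  host-vertex n M host =
    nonempty M (ℕₚ.<-≤-trans (ℕₚ.m^n>0 2 n) (ℕₚ.m≤m+n (2 ^ n) _)) (host-in-ℕ (2 ^ n) M host)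
    where
    nonempty : ∀ M {k r} → 0 ℕ.< k → k ℕ.≤ M ℕ.* r → Fin M
    nonempty ℕ.zero    0<k k≤0 = ⊥-elim (ℕₚ.<⇒≱ 0<k k≤0)
    nonempty (ℕ.suc M) _   _   = Data.Fin.zero

-- The greedy embedding works for every n (N = 0); a negative γ is excluded by 0 < γ.
lemma2p3 : (γ : ℚ) → 0ℚ < γ → γ < (+ 1) / 3 → (k : ℕ) →
    ∃ λ N → ∀ n → n ≥ N →
    ∀ (M : ℕ) (H : TwoColouring M) →
    (1ℚ + fromℕ 3 * γ) * fromℕ (2 ^ n) ≤ fromℕ M →
    NoBlueTriangle H →
    (∀ u → DegBound k n (dB H u)) →
    ∀ (m : ℕ) (A : PartialAssignment γ n H m) →
    Σ (Vec Bool n → Fin M) λ φ → GoodEmbedding A φ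
lemma2p3 (mkℚ -[1+ _ ] _ _) (*<* ()) _ _
lemma2p3 (mkℚ (+ p) q c) _ _ _ = 0 , λ n _ M H host _ _ m A →
  greedy-embedding A (host-vertex p q c n M host) p q (size-condition p q c A) (sparse-condition p q c A)
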